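{- For finite abstract simplicial complexes $G,H$, let $g=L_{G\times H}^{ -1}$. Then $\sum_{X,Y\in G\times H} g(X,Y)=\chi(G\times H)=\chi(G)\chi(H)$.
   Context: A finite abstract simplicial complex is a finite set of nonempty finite sets closed under taking nonempty subsets; $\dim(x)=|x|-1$ for a simplex $x$. Its connection matrix $L_G$ is indexed by $G\times G$ with $L_G(x,y)=1$ if $x\cap y\ne\emptyset$ and $0$ otherwise; it is known that $L_G$ is invertible (its determinant is $\pm1$). The product $G\times H$ is the set of pairs $(x,y)$, $x\in G$, $y\in H$, with connection matrix $L_{G\times H}((x,y),(a,b))=1$ if $x\cap a\ne\emptyset$ and $y\cap b\ne\emptyset$, and $0$ otherwise (this is invertible, being the Kronecker product $L_G\otimes L_H$). The Euler characteristics are $\chi(G)=\sum_{x\in G}(-1)^{\dim(x)}$ and $\chi(G\times H)=\sum_{(x,y)\in G\times H}(-1)^{\dim(x)+\dim(y)}$. -}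

module Defs where

open import Data.Nat using (ℕ; zero; suc; _∸_; _+_)
open import Data.Integer as ℤ using (ℤ; -_; 0ℤ; 1ℤ)
open import Data.Fin using (Fin; zero; suc)
open import Data.Fin.Subset using (Subset; _∩_; _⊆_; ∣_∣; Nonempty)
open import Data.Fin.Subset.Properties using (nonempty?)
open import Data.Fin.Properties using () renaming (_≟_ to _≟F_)
open import Data.List using (List; length; lookup)
open import Data.List.Membership.Propositional using (_∈_)
open import Data.List.Relation.Unary.All using (All)
open import Data.List.Relation.Unary.Unique.Propositional using (Unique)
open import Data.Product using (_×_; _,_; proj₁; proj₂)
open import Data.Bool using (if_then_else_; _∧_)
open import Relation.Nullary.Decidable using (does)
open import Relation.Binary.PropositionalEquality using (_≡_)

record Complex (n : ℕ) : Set where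
  field
    simplices : List (Subset n)
    distinct  : Unique simplices
    nonempty  : All Nonempty simplices
    closed    : ∀ {x y : Subset n} → x ∈ simplices → y ⊆ x → Nonempty y → y ∈ simplices

open Complex public

Idx : ∀ {n} → Complex n → Set
Idx G = Fin (length (simplices G))

simplex : ∀ {n} (G : Complex n) → Idx G → Subset n
simplex G i = lookup (simplices G) i

dim : ∀ {n} → Subset n → ℕ
dim x = ∣ x ∣ ∸ 1

negOnePow : ℕ → ℤ
negOnePow zero = 1ℤ
negOnePow (suc k) = - negOnePow k

sumFin : (k : ℕ) → (Fin k → ℤ) → ℤ
sumFin zero f = 0ℤ
sumFin (suc k) f = f zero ℤ.+ sumFin k (λ i → f (suc i))

χ : ∀ {n} → Complex n → ℤ
χ G = sumFin (length (simplices G)) (λ i → negOnePow (dim (simplex G i)))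

ProdIdx : ∀ {n m} → Complex n → Complex m → Set
ProdIdx G H = Idx G × Idx H

sumProd : ∀ {n m} (G : Complex n) (H : Complex m) → (ProdIdx G H → ℤ) → ℤ
sumProd G H f = sumFin (length (simplices G)) (λ i → sumFin (length (simplices H)) (λ j → f (i , j)))

χProd : ∀ {n m} → Complex n → Complex m → ℤ
χProd G H = sumProd G H (λ p → negOnePow (dim (simplex G (proj₁ p)) + dim (simplex H (proj₂ p))))

Matrix : ∀ {n m} → Complex n → Complex m → Set
Matrix G H = ProdIdx G H → ProdIdx G H → ℤ

connProd : ∀ {n m} (G : Complex n) (H : Complex m) → Matrix G H
connProd G H (i , j) (k , l) =
  if does (nonempty? (simplex G i ∩ simplex G k)) ∧ does (nonempty? (simplex H j ∩ simplex H l))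
  then 1ℤ else 0ℤ

idProd : ∀ {n m} (G : Complex n) (H : Complex m) → Matrix G H
idProd G H (i , j) (k , l) = if does (i ≟F k) ∧ does (j ≟F l) then 1ℤ else 0ℤ

mulProd : ∀ {n m} (G : Complex n) (H : Complex m) → Matrix G H → Matrix G H → Matrix G H
mulProd G H A B X Z = sumProd G H (λ Y → A X Y ℤ.* B Y Z)

IsInverse : ∀ {n m} (G : Complex n) (H : Complex m) → Matrix G H → Matrix G H → Set
IsInverse G H A g = (∀ X Z → mulProd G H A g X Z ≡ idProd G H X Z)
                  × (∀ X Z → mulProd G H g A X Z ≡ idProd G H X Z)

module Submission where

-- Write ω S = (-1)^dim S and, for a simplex x_k of G, χ-star k = Σ_{x_z ⊇ x_k} ω(x_z) (the Euler
-- characteristic of the open star). The vector weight k = ω(x_k) · χ-star k satisfies L_G weight = 1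
-- and Σ_k weight k = χ(G). After exchanging the order of summation both identities reduce, since G is
-- closed under faces, to inclusion-exclusion over the faces of one simplex z: the sum of ω(S) over the
-- nonempty S ⊆ z meeting y is [z ⊆ y]. As L_{G×H} = L_G ⊗ L_H, the vector weight_G ⊗ weight_H solves
-- L_{G×H} U = 1, so it is the vector of row sums of g = L_{G×H}⁻¹ (only g L = 1 is needed); summing
-- it gives χ(G) χ(H), which is χ(G×H) because (-1)^(dim x + dim y) factorizes.

open import Defs
open import Data.Nat as ℕ using (ℕ; zero; suc)
open import Data.Integer using (ℤ; -_; 0ℤ; 1ℤ; _+_; _-_; _*_)
open import Data.Integer.Properties
open import Data.Bool using (Bool; true; false; if_then_else_; _∧_; _∨_)
open import Data.Bool.Properties using (if-eta; if-float) renaming (_≟_ to _≟B_)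
open import Data.Fin using (Fin; zero; suc)
open import Data.Fin.Properties using () renaming (_≟_ to _≟F_)
open import Data.Vec using ([]; _∷_; here; there)
open import Data.Vec.Properties using (≡-dec)
open import Data.Fin.Subset using (Subset; _∩_; _⊆_; ∣_∣; Nonempty; Empty)
open import Data.Fin.Subset.Properties
  using (nonempty?; _⊆?_; out⊆; in⊆in; p∩q⊆q; x∈p∩q⁺; ⊆-refl)
open import Data.List using (List; []; _∷_; length; lookup)
open import Data.List.Membership.Propositional using (_∈_)
open import Data.List.Membership.Propositional.Properties using (∈-lookup)
import Data.List.Membership.DecPropositional as DecMembership
open import Data.List.Relation.Unary.All as All using ()
open import Data.List.Relation.Unary.AllPairs using (_∷_)
open import Data.List.Relation.Unary.Unique.Propositional using (Unique)
open import Data.Product using (_×_; _,_)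
open import Relation.Nullary using (Dec; yes; no; does; contradiction)
open import Relation.Nullary.Decidable using (dec-true; dec-false)
open import Relation.Binary.PropositionalEquality
open import Algebra.Properties.Semiring.Sum +-*-semiring
  using (sum; sum-cong-≗; ∑-comm; *-distribˡ-sum; *-distribʳ-sum; sum-replicate-zero)
open import Algebra.Properties.CommutativeSemigroup +-commutativeSemigroup
  using () renaming (interchange to +-interchange)
open import Algebra.Properties.CommutativeSemigroup *-commutativeSemigroup
  using () renaming (interchange to *-interchange)
open ≡-Reasoning

𝟙 : Bool → ℤ
𝟙 b = if b then 1ℤ else 0ℤ

𝟙-∧ : ∀ a b → 𝟙 (a ∧ b) ≡ 𝟙 a * 𝟙 b
𝟙-∧ false false = refl
𝟙-∧ false true  = refl
𝟙-∧ true  false = refl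
𝟙-∧ true  true  = refl

𝟙-* : ∀ b v → 𝟙 b * v ≡ (if b then v else 0ℤ)
𝟙-* false v = *-zeroˡ v
𝟙-* true  v = *-identityˡ v

*-if-comm : ∀ b u v → u * (if b then v else 0ℤ) ≡ v * (if b then u else 0ℤ)
*-if-comm false u v = trans (*-zeroʳ u) (sym (*-zeroʳ v))
*-if-comm true  u v = *-comm u v

𝟙-*-if-comm : ∀ a b u v →
  𝟙 a * (u * (if b then v else 0ℤ)) ≡ v * (if b then (if a then u else 0ℤ) else 0ℤ)
𝟙-*-if-comm false b u v = sym (trans (cong (v *_) (if-eta b)) (*-zeroʳ v))
𝟙-*-if-comm true  b u v = trans (*-identityˡ _) (*-if-comm b u v)

negOnePow-+ : ∀ a b → negOnePow (a ℕ.+ b) ≡ negOnePow a * negOnePow b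
negOnePow-+ zero    b = sym (*-identityˡ (negOnePow b))
negOnePow-+ (suc a) b = trans (cong -_ (negOnePow-+ a b)) (neg-distribˡ-* (negOnePow a) (negOnePow b))

sumFin≡sum : ∀ k (f : Fin k → ℤ) → sumFin k f ≡ sum f
sumFin≡sum zero    f = refl
sumFin≡sum (suc k) f = cong (f zero +_) (sumFin≡sum k (λ i → f (suc i)))

sumFin-cong : ∀ k {f g : Fin k → ℤ} → (∀ i → f i ≡ g i) → sumFin k f ≡ sumFin k g
sumFin-cong k {f} {g} f≗g = begin
  sumFin k f ≡⟨ sumFin≡sum k f ⟩
  sum f      ≡⟨ sum-cong-≗ f≗g ⟩
  sum g      ≡⟨ sumFin≡sum k g ⟨
  sumFin k g ∎

sumFin-0 : ∀ k → sumFin k (λ _ → 0ℤ) ≡ 0ℤ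
sumFin-0 k = trans (sumFin≡sum k _) (sum-replicate-zero k)

sumFin-*ˡ : ∀ k c (f : Fin k → ℤ) → c * sumFin k f ≡ sumFin k (λ i → c * f i)
sumFin-*ˡ k c f = begin
  c * sumFin k f              ≡⟨ cong (c *_) (sumFin≡sum k f) ⟩
  c * sum f                   ≡⟨ *-distribˡ-sum c f ⟩
  sum (λ i → c * f i)         ≡⟨ sumFin≡sum k _ ⟨
  sumFin k (λ i → c * f i)    ∎

sumFin-*ʳ : ∀ k c (f : Fin k → ℤ) → sumFin k f * c ≡ sumFin k (λ i → f i * c)
sumFin-*ʳ k c f = begin
  sumFin k f * c              ≡⟨ cong (_* c) (sumFin≡sum k f) ⟩
  sum f * c                   ≡⟨ *-distribʳ-sum c f ⟩
  sum (λ i → f i * c)         ≡⟨ sumFin≡sum k _ ⟨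
  sumFin k (λ i → f i * c)    ∎

sumFin-comm : ∀ a b (f : Fin a → Fin b → ℤ) →
  sumFin a (λ i → sumFin b (f i)) ≡ sumFin b (λ j → sumFin a (λ i → f i j))
sumFin-comm a b f = begin
  sumFin a (λ i → sumFin b (f i))          ≡⟨ sumFin-cong a (λ i → sumFin≡sum b (f i)) ⟩
  sumFin a (λ i → sum (f i))               ≡⟨ sumFin≡sum a _ ⟩
  sum (λ i → sum (f i))                    ≡⟨ ∑-comm f ⟩
  sum (λ j → sum (λ i → f i j))            ≡⟨ sumFin≡sum b _ ⟨
  sumFin b (λ j → sum (λ i → f i j))       ≡⟨ sumFin-cong b (λ j → sumFin≡sum a (λ i → f i j)) ⟨
  sumFin b (λ j → sumFin a (λ i → f i j))  ∎

sumFin-⊗ : ∀ a b (f : Fin a → ℤ) (g : Fin b → ℤ) →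
  sumFin a (λ i → sumFin b (λ j → f i * g j)) ≡ sumFin a f * sumFin b g
sumFin-⊗ a b f g = begin
  sumFin a (λ i → sumFin b (λ j → f i * g j)) ≡⟨ sumFin-cong a (λ i → sumFin-*ˡ b (f i) g) ⟨
  sumFin a (λ i → f i * sumFin b g)           ≡⟨ sumFin-*ʳ a (sumFin b g) f ⟨
  sumFin a f * sumFin b g                     ∎

sumFin-δ : ∀ k (i : Fin k) (f : Fin k → ℤ) → sumFin k (λ j → 𝟙 (does (i ≟F j)) * f j) ≡ f i
sumFin-δ (suc k) zero f =
  trans (cong₂ _+_ (*-identityˡ (f zero)) (sumFin-0 k)) (+-identityʳ (f zero))
sumFin-δ (suc k) (suc i) f = trans (+-identityˡ _) (sumFin-δ k i (λ j → f (suc j)))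

sumSubsets : ∀ {n} → Subset n → (Subset n → ℤ) → ℤ
sumSubsets []          f = f []
sumSubsets (false ∷ z) f = sumSubsets z (λ S → f (false ∷ S))
sumSubsets (true  ∷ z) f = sumSubsets z (λ S → f (false ∷ S)) + sumSubsets z (λ S → f (true ∷ S))

syntax sumSubsets z (λ S → e) = ∑[ S ⊆ z ] e

∑⊆-cong : ∀ {n} (z : Subset n) {f g : Subset n → ℤ} →
  (∀ S → S ⊆ z → f S ≡ g S) → ∑[ S ⊆ z ] f S ≡ ∑[ S ⊆ z ] g S
∑⊆-cong []          f≗g = f≗g [] λ ()
∑⊆-cong (false ∷ z) f≗g = ∑⊆-cong z (λ S S⊆z → f≗g _ (out⊆ S⊆z))
∑⊆-cong (true  ∷ z) f≗g =
  cong₂ _+_ (∑⊆-cong z (λ S S⊆z → f≗g _ (out⊆ S⊆z))) (∑⊆-cong z (λ S S⊆z → f≗g _ (in⊆in S⊆z)))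

∑⊆-0 : ∀ {n} (z : Subset n) → ∑[ S ⊆ z ] 0ℤ ≡ 0ℤ
∑⊆-0 []          = refl
∑⊆-0 (false ∷ z) = ∑⊆-0 z
∑⊆-0 (true  ∷ z) = cong₂ _+_ (∑⊆-0 z) (∑⊆-0 z)

∑⊆-distrib-+ : ∀ {n} (z : Subset n) (f g : Subset n → ℤ) →
  ∑[ S ⊆ z ] (f S + g S) ≡ ∑[ S ⊆ z ] f S + ∑[ S ⊆ z ] g S
∑⊆-distrib-+ []          f g = refl
∑⊆-distrib-+ (false ∷ z) f g = ∑⊆-distrib-+ z (λ S → f (false ∷ S)) (λ S → g (false ∷ S))
∑⊆-distrib-+ (true  ∷ z) f g = begin
  ∑[ S ⊆ z ] (f₀ S + g₀ S) + ∑[ S ⊆ z ] (f₁ S + g₁ S)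
    ≡⟨ cong₂ _+_ (∑⊆-distrib-+ z f₀ g₀) (∑⊆-distrib-+ z f₁ g₁) ⟩
  (∑[ S ⊆ z ] f₀ S + ∑[ S ⊆ z ] g₀ S) + (∑[ S ⊆ z ] f₁ S + ∑[ S ⊆ z ] g₁ S)
    ≡⟨ +-interchange (sumSubsets z f₀) (sumSubsets z g₀) (sumSubsets z f₁) (sumSubsets z g₁) ⟩
  (∑[ S ⊆ z ] f₀ S + ∑[ S ⊆ z ] f₁ S) + (∑[ S ⊆ z ] g₀ S + ∑[ S ⊆ z ] g₁ S) ∎
  where
  f₀ f₁ g₀ g₁ : Subset _ → ℤ
  f₀ S = f (false ∷ S)
  f₁ S = f (true ∷ S)
  g₀ S = g (false ∷ S)
  g₁ S = g (true ∷ S)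

∑⊆-neg : ∀ {n} (z : Subset n) (f : Subset n → ℤ) → ∑[ S ⊆ z ] (- f S) ≡ - ∑[ S ⊆ z ] f S
∑⊆-neg []          f = refl
∑⊆-neg (false ∷ z) f = ∑⊆-neg z (λ S → f (false ∷ S))
∑⊆-neg (true  ∷ z) f =
  trans (cong₂ _+_ (∑⊆-neg z (λ S → f (false ∷ S))) (∑⊆-neg z (λ S → f (true ∷ S))))
        (sym (neg-distrib-+ (sumSubsets z (λ S → f (false ∷ S))) (sumSubsets z (λ S → f (true ∷ S)))))

infix 4 _≟ˢ_ _∈?_

_≟ˢ_ : ∀ {n} (S T : Subset n) → Dec (S ≡ T)
_≟ˢ_ = ≡-dec _≟B_

_∈?_ : ∀ {n} (S : Subset n) (l : List (Subset n)) → Dec (S ∈ l)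
S ∈? l = DecMembership._∈?_ _≟ˢ_ S l

∑⊆-δ : ∀ {n} (z a : Subset n) (f : Subset n → ℤ) →
  ∑[ S ⊆ z ] (if does (S ≟ˢ a) then f S else 0ℤ) ≡ (if does (a ⊆? z) then f a else 0ℤ)
∑⊆-δ []          []          f = refl
∑⊆-δ (false ∷ z) (false ∷ a) f = ∑⊆-δ z a (λ S → f (false ∷ S))
∑⊆-δ (false ∷ z) (true  ∷ a) f = ∑⊆-0 z
∑⊆-δ (true  ∷ z) (false ∷ a) f =
  trans (cong₂ _+_ (∑⊆-δ z a (λ S → f (false ∷ S))) (∑⊆-0 z)) (+-identityʳ _)
∑⊆-δ (true  ∷ z) (true  ∷ a) f =
  trans (cong₂ _+_ (∑⊆-0 z) (∑⊆-δ z a (λ S → f (true ∷ S)))) (+-identityˡ _)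

-- A structural test for Nonempty (p ∩ q): unlike nonempty?, it computes on cons cells, which the
-- inductions over subsets below rely on.
intersects : ∀ {n} → Subset n → Subset n → Bool
intersects []      []      = false
intersects (a ∷ p) (b ∷ q) = (a ∧ b) ∨ intersects p q

intersects⇒nonempty-∩ : ∀ {n} (p q : Subset n) → intersects p q ≡ true → Nonempty (p ∩ q)
intersects⇒nonempty-∩ []          []          ()
intersects⇒nonempty-∩ (true  ∷ p) (true  ∷ q) _ = zero , here
intersects⇒nonempty-∩ (true  ∷ p) (false ∷ q) h with i , i∈ ← intersects⇒nonempty-∩ p q h = suc i , there i∈
intersects⇒nonempty-∩ (false ∷ p) (b     ∷ q) h with i , i∈ ← intersects⇒nonempty-∩ p q h = suc i , there i∈

nonempty-∩⇒intersects : ∀ {n} (p q : Subset n) → Nonempty (p ∩ q) → intersects p q ≡ true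
nonempty-∩⇒intersects (true  ∷ p) (true  ∷ q) _                 = refl
nonempty-∩⇒intersects (true  ∷ p) (false ∷ q) (suc i , there i∈) = nonempty-∩⇒intersects p q (i , i∈)
nonempty-∩⇒intersects (false ∷ p) (b     ∷ q) (suc i , there i∈) = nonempty-∩⇒intersects p q (i , i∈)

does-nonempty?-∩ : ∀ {n} (p q : Subset n) → does (nonempty? (p ∩ q)) ≡ intersects p q
does-nonempty?-∩ p q with intersects p q in eq
... | true  = dec-true (nonempty? (p ∩ q)) (intersects⇒nonempty-∩ p q eq)
... | false = dec-false (nonempty? (p ∩ q)) λ ne →
                contradiction (trans (sym eq) (nonempty-∩⇒intersects p q ne)) λ ()

sgn : ∀ {n} → Subset n → ℤ
sgn S = negOnePow ∣ S ∣

ω : ∀ {n} → Subset n → ℤ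
ω S = negOnePow (dim S)

-- Needs S nonempty: dim ∅ = 0 ∸ 1 = 0, so ω ∅ = sgn ∅ = 1.
ω≡-sgn : ∀ {n} {S : Subset n} → Nonempty S → ω S ≡ - sgn S
ω≡-sgn {S = true  ∷ S} _                  = sym (neg-involutive (negOnePow ∣ S ∣))
ω≡-sgn {S = false ∷ S} (suc i , there i∈) = ω≡-sgn (i , i∈)

∑⊆-sgn : ∀ {n} (z : Subset n) → Nonempty z → ∑[ S ⊆ z ] sgn S ≡ 0ℤ
∑⊆-sgn (true  ∷ z) _ = begin
  ∑[ S ⊆ z ] sgn S + ∑[ S ⊆ z ] (- sgn S) ≡⟨ cong (sumSubsets z sgn +_) (∑⊆-neg z sgn) ⟩
  ∑[ S ⊆ z ] sgn S - ∑[ S ⊆ z ] sgn S     ≡⟨ +-inverseʳ (sumSubsets z sgn) ⟩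
  0ℤ                                      ∎
∑⊆-sgn (false ∷ z) (suc i , there i∈) = ∑⊆-sgn z (i , i∈)

-- The subsets of z disjoint from y are those of z ∖ y, and their alternating sum vanishes unless z ∖ y = ∅.
∑⊆-sgn-disjoint : ∀ {n} (z y : Subset n) →
  ∑[ S ⊆ z ] (if intersects y S then 0ℤ else sgn S) ≡ 𝟙 (does (z ⊆? y))
∑⊆-sgn-disjoint []          []          = refl
∑⊆-sgn-disjoint (false ∷ z) (false ∷ y) = ∑⊆-sgn-disjoint z y
∑⊆-sgn-disjoint (false ∷ z) (true  ∷ y) = ∑⊆-sgn-disjoint z y
∑⊆-sgn-disjoint (true  ∷ z) (true  ∷ y) =
  trans (cong₂ _+_ (∑⊆-sgn-disjoint z y) (∑⊆-0 z)) (+-identityʳ _)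
∑⊆-sgn-disjoint (true  ∷ z) (false ∷ y) = begin
  A + ∑[ S ⊆ z ] (if intersects y S then 0ℤ else - sgn S)
    ≡⟨ cong (A +_) (∑⊆-cong z (λ S _ → sym (if-float -_ (intersects y S)))) ⟩
  A + ∑[ S ⊆ z ] (- (if intersects y S then 0ℤ else sgn S))
    ≡⟨ cong (A +_) (∑⊆-neg z _) ⟩
  A - A
    ≡⟨ +-inverseʳ A ⟩
  0ℤ ∎
  where A = ∑[ S ⊆ z ] (if intersects y S then 0ℤ else sgn S)

∑⊆-ω-intersecting : ∀ {n} (z y : Subset n) → Nonempty z →
  ∑[ S ⊆ z ] (if intersects y S then ω S else 0ℤ) ≡ 𝟙 (does (z ⊆? y))
∑⊆-ω-intersecting z y z≢∅ = begin
  ∑[ S ⊆ z ] (if intersects y S then ω S else 0ℤ)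
    ≡⟨ ∑⊆-cong z (λ S _ → split S) ⟩
  ∑[ S ⊆ z ] ((if intersects y S then 0ℤ else sgn S) - sgn S)
    ≡⟨ ∑⊆-distrib-+ z _ (λ S → - sgn S) ⟩
  ∑[ S ⊆ z ] (if intersects y S then 0ℤ else sgn S) + ∑[ S ⊆ z ] (- sgn S)
    ≡⟨ cong₂ _+_ (∑⊆-sgn-disjoint z y) (trans (∑⊆-neg z sgn) (cong -_ (∑⊆-sgn z z≢∅))) ⟩
  𝟙 (does (z ⊆? y)) + 0ℤ
    ≡⟨ +-identityʳ _ ⟩
  𝟙 (does (z ⊆? y)) ∎
  where
  split : ∀ S → (if intersects y S then ω S else 0ℤ) ≡ (if intersects y S then 0ℤ else sgn S) - sgn S
  split S with intersects y S in eq
  ... | true with i , i∈y∩S ← intersects⇒nonempty-∩ y S eq =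
    trans (ω≡-sgn (i , p∩q⊆q y S i∈y∩S)) (sym (+-identityˡ _))
  ... | false = sym (+-inverseʳ (sgn S))

sumFin-lookup : ∀ {n} (l : List (Subset n)) → Unique l → ∀ z (f : Subset n → ℤ) →
  sumFin (length l) (λ k → if does (lookup l k ⊆? z) then f (lookup l k) else 0ℤ)
    ≡ ∑[ S ⊆ z ] (if does (S ∈? l) then f S else 0ℤ)
sumFin-lookup []      _          z f = sym (∑⊆-0 z)
sumFin-lookup (a ∷ l) (a∉l ∷ !l) z f = begin
  (if does (a ⊆? z) then f a else 0ℤ) + sumFin (length l) _
    ≡⟨ cong₂ _+_ (sym (∑⊆-δ z a f)) (sumFin-lookup l !l z f) ⟩
  ∑[ S ⊆ z ] (if does (S ≟ˢ a) then f S else 0ℤ) + ∑[ S ⊆ z ] (if does (S ∈? l) then f S else 0ℤ)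
    ≡⟨ ∑⊆-distrib-+ z _ _ ⟨
  ∑[ S ⊆ z ] ((if does (S ≟ˢ a) then f S else 0ℤ) + (if does (S ∈? l) then f S else 0ℤ))
    ≡⟨ ∑⊆-cong z (λ S _ → disjoint S) ⟩
  ∑[ S ⊆ z ] (if does (S ∈? a ∷ l) then f S else 0ℤ) ∎
  where
  disjoint : ∀ S → (if does (S ≟ˢ a) then f S else 0ℤ) + (if does (S ∈? l) then f S else 0ℤ)
                     ≡ (if does (S ∈? a ∷ l) then f S else 0ℤ)
  disjoint S with S ≟ˢ a | S ∈? l
  ... | yes refl | yes S∈l = contradiction refl (All.lookup a∉l S∈l)
  ... | yes _    | no _    = +-identityʳ (f S)
  ... | no _     | _       = +-identityˡ _

module _ {n} (G : Complex n) where
  private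
    N : ℕ
    N = length (simplices G)

    x : Idx G → Subset n
    x = simplex G

  simplex-nonempty : ∀ k → Nonempty (simplex G k)
  simplex-nonempty k = All.lookup (nonempty G) (∈-lookup k)

  sumFin-faces : ∀ j (f : Subset n → ℤ) → (∀ S → Empty S → f S ≡ 0ℤ) →
    sumFin N (λ k → if does (x k ⊆? x j) then f (x k) else 0ℤ) ≡ ∑[ S ⊆ x j ] f S
  sumFin-faces j f f∅≡0 = trans (sumFin-lookup (simplices G) (distinct G) (x j) f) (∑⊆-cong (x j) restrict)
    where
    restrict : ∀ S → S ⊆ x j → (if does (S ∈? simplices G) then f S else 0ℤ) ≡ f S
    restrict S S⊆xⱼ with nonempty? S
    ... | yes S≢∅ rewrite dec-true (S ∈? simplices G) (closed G (∈-lookup j) S⊆xⱼ S≢∅) = refl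
    ... | no  S-empty rewrite f∅≡0 S S-empty = if-eta _

  sumFin-faces-ω-intersecting : ∀ j y →
    sumFin N (λ k → if does (x k ⊆? x j) then (if intersects y (x k) then ω (x k) else 0ℤ) else 0ℤ)
      ≡ 𝟙 (does (x j ⊆? y))
  sumFin-faces-ω-intersecting j y =
    trans (sumFin-faces j _ vanish) (∑⊆-ω-intersecting (x j) y (simplex-nonempty j))
    where
    vanish : ∀ S → Empty S → (if intersects y S then ω S else 0ℤ) ≡ 0ℤ
    vanish S S-empty with intersects y S in eq
    ... | true  = let i , i∈y∩S = intersects⇒nonempty-∩ y S eq in contradiction (i , p∩q⊆q y S i∈y∩S) S-empty
    ... | false = refl

  sumFin-faces-ω : ∀ j → sumFin N (λ k → if does (x k ⊆? x j) then ω (x k) else 0ℤ) ≡ 1ℤ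
  sumFin-faces-ω j = begin
    sumFin N (λ k → if does (x k ⊆? x j) then ω (x k) else 0ℤ)
      ≡⟨ sumFin-cong N faces-intersect ⟩
    sumFin N (λ k → if does (x k ⊆? x j) then (if intersects (x j) (x k) then ω (x k) else 0ℤ) else 0ℤ)
      ≡⟨ sumFin-faces-ω-intersecting j (x j) ⟩
    𝟙 (does (x j ⊆? x j))
      ≡⟨ cong 𝟙 (dec-true (x j ⊆? x j) ⊆-refl) ⟩
    1ℤ ∎
    where
    faces-intersect : ∀ k → (if does (x k ⊆? x j) then ω (x k) else 0ℤ)
                              ≡ (if does (x k ⊆? x j) then (if intersects (x j) (x k) then ω (x k) else 0ℤ) else 0ℤ)
    faces-intersect k with x k ⊆? x j
    ... | no _      = refl
    ... | yes xₖ⊆xⱼ with i , i∈xₖ ← simplex-nonempty k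
                    rewrite nonempty-∩⇒intersects (x j) (x k) (i , x∈p∩q⁺ (xₖ⊆xⱼ i∈xₖ , i∈xₖ)) = refl

  conn : Idx G → Idx G → ℤ
  conn i k = 𝟙 (does (nonempty? (x i ∩ x k)))

  χ-star : Idx G → ℤ
  χ-star k = sumFin N (λ z → if does (x k ⊆? x z) then ω (x z) else 0ℤ)

  weight : Idx G → ℤ
  weight k = ω (x k) * χ-star k

  conn-weight : ∀ i → sumFin N (λ k → conn i k * weight k) ≡ 1ℤ
  conn-weight i = begin
    sumFin N (λ k → conn i k * (ω (x k) * χ-star k))
      ≡⟨ sumFin-cong N (λ k → trans (cong (conn i k *_) (sumFin-*ˡ N (ω (x k)) (E k)))
                                     (sumFin-*ˡ N (conn i k) _)) ⟩
    sumFin N (λ k → sumFin N (λ z → conn i k * (ω (x k) * E k z)))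
      ≡⟨ sumFin-comm N N _ ⟩
    sumFin N (λ z → sumFin N (λ k → conn i k * (ω (x k) * E k z)))
      ≡⟨ sumFin-cong N (λ z → sumFin-cong N (λ k → rearrange k z)) ⟩
    sumFin N (λ z → sumFin N (λ k → ω (x z) * F k z))
      ≡⟨ sumFin-cong N (λ z → sumFin-*ˡ N (ω (x z)) (λ k → F k z)) ⟨
    sumFin N (λ z → ω (x z) * sumFin N (λ k → F k z))
      ≡⟨ sumFin-cong N (λ z → cong (ω (x z) *_) (sumFin-faces-ω-intersecting z (x i))) ⟩
    sumFin N (λ z → ω (x z) * 𝟙 (does (x z ⊆? x i)))
      ≡⟨ sumFin-cong N (λ z → trans (*-comm (ω (x z)) _) (𝟙-* _ (ω (x z)))) ⟩
    sumFin N (λ z → if does (x z ⊆? x i) then ω (x z) else 0ℤ)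
      ≡⟨ sumFin-faces-ω i ⟩
    1ℤ ∎
    where
    E F : Idx G → Idx G → ℤ
    E k z = if does (x k ⊆? x z) then ω (x z) else 0ℤ
    F k z = if does (x k ⊆? x z) then (if intersects (x i) (x k) then ω (x k) else 0ℤ) else 0ℤ
    rearrange : ∀ k z → conn i k * (ω (x k) * E k z) ≡ ω (x z) * F k z
    rearrange k z rewrite does-nonempty?-∩ (x i) (x k) =
      𝟙-*-if-comm (intersects (x i) (x k)) (does (x k ⊆? x z)) (ω (x k)) (ω (x z))

  sumFin-weight : sumFin N weight ≡ χ G
  sumFin-weight = begin
    sumFin N (λ k → ω (x k) * χ-star k)
      ≡⟨ sumFin-cong N (λ k → sumFin-*ˡ N (ω (x k)) _) ⟩
    sumFin N (λ k → sumFin N (λ z → ω (x k) * (if does (x k ⊆? x z) then ω (x z) else 0ℤ)))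
      ≡⟨ sumFin-comm N N _ ⟩
    sumFin N (λ z → sumFin N (λ k → ω (x k) * (if does (x k ⊆? x z) then ω (x z) else 0ℤ)))
      ≡⟨ sumFin-cong N (λ z → sumFin-cong N (λ k → *-if-comm (does (x k ⊆? x z)) (ω (x k)) (ω (x z)))) ⟩
    sumFin N (λ z → sumFin N (λ k → ω (x z) * (if does (x k ⊆? x z) then ω (x k) else 0ℤ)))
      ≡⟨ sumFin-cong N (λ z → sumFin-*ˡ N (ω (x z)) _) ⟨
    sumFin N (λ z → ω (x z) * sumFin N (λ k → if does (x k ⊆? x z) then ω (x k) else 0ℤ))
      ≡⟨ sumFin-cong N (λ z → trans (cong (ω (x z) *_) (sumFin-faces-ω z)) (*-identityʳ (ω (x z)))) ⟩
    χ G ∎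

module _ {n m} (G : Complex n) (H : Complex m) where
  private
    NG NH : ℕ
    NG = length (simplices G)
    NH = length (simplices H)

  sumProd-cong : ∀ {f g : ProdIdx G H → ℤ} → (∀ Y → f Y ≡ g Y) → sumProd G H f ≡ sumProd G H g
  sumProd-cong f≗g = sumFin-cong NG (λ i → sumFin-cong NH (λ j → f≗g (i , j)))

  sumProd-*ˡ : ∀ c (f : ProdIdx G H → ℤ) → c * sumProd G H f ≡ sumProd G H (λ Y → c * f Y)
  sumProd-*ˡ c f = trans (sumFin-*ˡ NG c _) (sumFin-cong NG (λ i → sumFin-*ˡ NH c _))

  sumProd-*ʳ : ∀ c (f : ProdIdx G H → ℤ) → sumProd G H f * c ≡ sumProd G H (λ Y → f Y * c)
  sumProd-*ʳ c f = trans (sumFin-*ʳ NG c _) (sumFin-cong NG (λ i → sumFin-*ʳ NH c _))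

  sumProd-comm : ∀ (f : ProdIdx G H → ProdIdx G H → ℤ) →
    sumProd G H (λ Y → sumProd G H (f Y)) ≡ sumProd G H (λ Z → sumProd G H (λ Y → f Y Z))
  sumProd-comm f = begin
    sumFin NG (λ i → sumFin NH (λ j → sumFin NG (λ k → sumFin NH (λ l → f (i , j) (k , l)))))
      ≡⟨ sumFin-cong NG (λ i → sumFin-comm NH NG _) ⟩
    sumFin NG (λ i → sumFin NG (λ k → sumFin NH (λ j → sumFin NH (λ l → f (i , j) (k , l)))))
      ≡⟨ sumFin-cong NG (λ i → sumFin-cong NG (λ k → sumFin-comm NH NH _)) ⟩
    sumFin NG (λ i → sumFin NG (λ k → sumFin NH (λ l → sumFin NH (λ j → f (i , j) (k , l)))))
      ≡⟨ sumFin-comm NG NG _ ⟩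
    sumFin NG (λ k → sumFin NG (λ i → sumFin NH (λ l → sumFin NH (λ j → f (i , j) (k , l)))))
      ≡⟨ sumFin-cong NG (λ k → sumFin-comm NG NH _) ⟩
    sumFin NG (λ k → sumFin NH (λ l → sumFin NG (λ i → sumFin NH (λ j → f (i , j) (k , l))))) ∎

  sumProd-idProd : ∀ X (v : ProdIdx G H → ℤ) → sumProd G H (λ Z → idProd G H X Z * v Z) ≡ v X
  sumProd-idProd (i , j) v = begin
    sumFin NG (λ k → sumFin NH (λ l → 𝟙 (does (i ≟F k) ∧ does (j ≟F l)) * v (k , l)))
      ≡⟨ sumFin-cong NG (λ k → sumFin-cong NH (λ l → factor k l)) ⟩
    sumFin NG (λ k → sumFin NH (λ l → 𝟙 (does (i ≟F k)) * (𝟙 (does (j ≟F l)) * v (k , l))))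
      ≡⟨ sumFin-cong NG (λ k → sumFin-*ˡ NH (𝟙 (does (i ≟F k))) (λ l → 𝟙 (does (j ≟F l)) * v (k , l))) ⟨
    sumFin NG (λ k → 𝟙 (does (i ≟F k)) * sumFin NH (λ l → 𝟙 (does (j ≟F l)) * v (k , l)))
      ≡⟨ sumFin-cong NG (λ k → cong (𝟙 (does (i ≟F k)) *_) (sumFin-δ NH j (λ l → v (k , l)))) ⟩
    sumFin NG (λ k → 𝟙 (does (i ≟F k)) * v (k , j))
      ≡⟨ sumFin-δ NG i (λ k → v (k , j)) ⟩
    v (i , j) ∎
    where
    factor : ∀ k l → 𝟙 (does (i ≟F k) ∧ does (j ≟F l)) * v (k , l)
                       ≡ 𝟙 (does (i ≟F k)) * (𝟙 (does (j ≟F l)) * v (k , l))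
    factor k l = trans (cong (_* v (k , l)) (𝟙-∧ (does (i ≟F k)) (does (j ≟F l))))
                       (*-assoc (𝟙 (does (i ≟F k))) (𝟙 (does (j ≟F l))) (v (k , l)))

  rowSum-leftInverse : ∀ (A g : Matrix G H) (v : ProdIdx G H → ℤ) →
    (∀ X Z → mulProd G H g A X Z ≡ idProd G H X Z) →
    (∀ Y → sumProd G H (λ Z → A Y Z * v Z) ≡ 1ℤ) →
    ∀ X → sumProd G H (g X) ≡ v X
  rowSum-leftInverse A g v gA≡I Av≡1 X = begin
    sumProd G H (λ Y → g X Y)
      ≡⟨ sumProd-cong (λ Y → trans (sym (*-identityʳ (g X Y))) (cong (g X Y *_) (sym (Av≡1 Y)))) ⟩
    sumProd G H (λ Y → g X Y * sumProd G H (λ Z → A Y Z * v Z))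
      ≡⟨ sumProd-cong (λ Y → trans (sumProd-*ˡ (g X Y) _)
                                   (sumProd-cong (λ Z → sym (*-assoc (g X Y) (A Y Z) (v Z))))) ⟩
    sumProd G H (λ Y → sumProd G H (λ Z → g X Y * A Y Z * v Z))
      ≡⟨ sumProd-comm _ ⟩
    sumProd G H (λ Z → sumProd G H (λ Y → g X Y * A Y Z * v Z))
      ≡⟨ sumProd-cong (λ Z → sumProd-*ʳ (v Z) _) ⟨
    sumProd G H (λ Z → mulProd G H g A X Z * v Z)
      ≡⟨ sumProd-cong (λ Z → cong (_* v Z) (gA≡I X Z)) ⟩
    sumProd G H (λ Z → idProd G H X Z * v Z)
      ≡⟨ sumProd-idProd X v ⟩
    v X ∎

  connProd-⊗ : ∀ i j k l → connProd G H (i , j) (k , l) ≡ conn G i k * conn H j l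
  connProd-⊗ i j k l =
    𝟙-∧ (does (nonempty? (simplex G i ∩ simplex G k))) (does (nonempty? (simplex H j ∩ simplex H l)))

  weight⊗ : ProdIdx G H → ℤ
  weight⊗ (k , l) = weight G k * weight H l

  connProd-weight⊗ : ∀ X → sumProd G H (λ Y → connProd G H X Y * weight⊗ Y) ≡ 1ℤ
  connProd-weight⊗ (i , j) = begin
    sumProd G H (λ (k , l) → connProd G H (i , j) (k , l) * (weight G k * weight H l))
      ≡⟨ sumProd-cong (λ (k , l) → trans (cong (_* _) (connProd-⊗ i j k l))
                                          (*-interchange (conn G i k) (conn H j l) (weight G k) (weight H l))) ⟩
    sumProd G H (λ (k , l) → (conn G i k * weight G k) * (conn H j l * weight H l))
      ≡⟨ sumFin-⊗ NG NH _ _ ⟩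
    sumFin NG (λ k → conn G i k * weight G k) * sumFin NH (λ l → conn H j l * weight H l)
      ≡⟨ cong₂ _*_ (conn-weight G i) (conn-weight H j) ⟩
    1ℤ ∎

  χProd-multiplicative : χProd G H ≡ χ G * χ H
  χProd-multiplicative =
    trans (sumProd-cong (λ (k , l) → negOnePow-+ (dim (simplex G k)) (dim (simplex H l)))) (sumFin-⊗ NG NH _ _)

mainTheorem16 : ∀ {n m} (G : Complex n) (H : Complex m) (g : Matrix G H) →
    IsInverse G H (connProd G H) g →
    (sumProd G H (λ X → sumProd G H (λ Y → g X Y)) ≡ χProd G H)
      × (χProd G H ≡ χ G * χ H)
mainTheorem16 G H g (_ , gL≡I) = sum-entries , χProd-multiplicative G H
  where
  sum-entries : sumProd G H (λ X → sumProd G H (λ Y → g X Y)) ≡ χProd G H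
  sum-entries = begin
    sumProd G H (λ X → sumProd G H (g X))
      ≡⟨ sumProd-cong G H (rowSum-leftInverse G H (connProd G H) g (weight⊗ G H) gL≡I (connProd-weight⊗ G H)) ⟩
    sumProd G H (weight⊗ G H)
      ≡⟨ sumFin-⊗ _ _ (weight G) (weight H) ⟩
    sumFin _ (weight G) * sumFin _ (weight H)
      ≡⟨ cong₂ _*_ (sumFin-weight G) (sumFin-weight H) ⟩
    χ G * χ H
      ≡⟨ χProd-multiplicative G H ⟨
    χProd G H ∎
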